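{- Let $f\in\mathbb{F}[x_1,\dots,x_n]$ of degree $m$ be computed by a staggered arithmetic circuit of size $s$ and width $w$, and suppose $\mathbb{F}$ has at least $\deg(f)+1$ elements. Then for each $i$, the $i$-th homogeneous component $H_i(f)$ of $f$ can be computed by a staggered arithmetic circuit of size $\mathrm{poly}(s,m)$ and width $w+O(1)$.
   Context: Polynomials are commutative. An arithmetic circuit has leaves labeled by variables or field constants and internal $+$/$\times$ gates of indegree two; it is layered if its nodes are partitioned into layers $V_1,\dots,V_t$, $V_1$ leaves, children of nodes in $V_i$ ($i>1$) in $V_1\cup V_{i-1}$; size is the number of nodes, width is $\max_{i>1}|V_i|$. A layered circuit is staggered if in each layer $i>1$ every node except possibly one is a product gate $g=u\times 1$ for a gate $u$ of the previous layer. $H_i(f)$ is the sum of the degree-$i$ terms of $f$. The $O(1)$ and $\mathrm{poly}$ are absolute (independent of $f,s,w,m$). -}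

module Defs where

open import Level using (Level; Lift)
open import Data.Empty using (⊥)
open import Data.Unit using (⊤)
open import Algebra.Bundles using (CommutativeRing)
open import Data.Nat as ℕ using (ℕ; zero; _∸_; _<_)
open import Data.Fin using (Fin)
open import Data.Vec as Vec using (Vec; []; _∷_; lookup)
import Data.Vec.Properties as VecP
open import Data.List as List using (List; []; _∷_; _++_; concatMap; upTo)
open import Data.List.Relation.Unary.Any using (Any)
open import Data.Product using (_×_; _,_; ∃; Σ)
open import Data.Sum using (_⊎_)
open import Relation.Nullary using (¬_; yes; no)
open import Relation.Binary.PropositionalEquality using (_≡_)

record Field (a ℓ : Level) : Set (Level.suc (a Level.⊔ ℓ)) where
  field
    commRing : CommutativeRing a ℓ
  open CommutativeRing commRing public
  field
    1≉0     : ¬ (1# ≈ 0#)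
    inverse : ∀ x → ¬ (x ≈ 0#) → Σ Carrier λ y → x * y ≈ 1#

module _ {a ℓ : Level} (F : Field a ℓ) where
  open Field F

  -- Formal polynomials in F[x_1..x_n], as coefficient functions on
  -- exponent vectors (monomials).  Finiteness of support is implied by
  -- the degree hypothesis / by circuit semantics.

  Monomial : ℕ → Set
  Monomial n = Vec ℕ n

  Poly : ℕ → Set a
  Poly n = Monomial n → Carrier

  ∣_∣ₘ : ∀ {n} → Monomial n → ℕ
  ∣ α ∣ₘ = Vec.sum α

  _≈ₚ_ : ∀ {n} → Poly n → Poly n → Set ℓ
  p ≈ₚ q = ∀ α → p α ≈ q α

  constP : ∀ {n} → Carrier → Poly n
  constP c α with VecP.≡-dec ℕ._≟_ α (Vec.replicate _ 0)
  ... | yes _ = c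
  ... | no  _ = 0#

  unitVec : ∀ {n} → Fin n → Monomial n
  unitVec {n} i = Vec.updateAt (Vec.replicate n 0) i (λ _ → 1)

  varP : ∀ {n} → Fin n → Poly n
  varP i α with VecP.≡-dec ℕ._≟_ α (unitVec i)
  ... | yes _ = 1#
  ... | no  _ = 0#

  addP : ∀ {n} → Poly n → Poly n → Poly n
  addP p q α = p α + q α

  splits : ∀ {n} → Monomial n → List (Monomial n × Monomial n)
  splits []      = ([] , []) ∷ []
  splits (k ∷ α) = concatMap (λ b → List.map (λ { (β , γ) → (b ∷ β , (k ∸ b) ∷ γ) }) (splits α))
                             (upTo (ℕ.suc k))

  sumF : List Carrier → Carrier
  sumF = List.foldr _+_ 0#

  mulP : ∀ {n} → Poly n → Poly n → Poly n
  mulP p q α = sumF (List.map (λ { (β , γ) → p β * q γ }) (splits α))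

  H : ∀ {n} → ℕ → Poly n → Poly n
  H i f α with ∣ α ∣ₘ ℕ.≟ i
  ... | yes _ = f α
  ... | no  _ = 0#

  -- f has degree m (convention: the zero polynomial has degree 0)
  HasDegree : ∀ {n} → Poly n → ℕ → Set _
  HasDegree f m =
    (∀ α → m < ∣ α ∣ₘ → f α ≈ 0#) ×
    ((∃ λ α → ∣ α ∣ₘ ≡ m × ¬ (f α ≈ 0#)) ⊎ ((m ≡ 0) × (∀ α → f α ≈ 0#)))

  AtLeast : ℕ → Set _
  AtLeast k = Σ (Fin k → Carrier) λ e → ∀ i j → e i ≈ e j → i ≡ j

  -- V_1 = the leaves (a vector of L leaf labels).  Each further layer is
  -- a vector of gates; a gate in a layer whose previous *gate* layer has
  -- p nodes has children that are leaves (V_1) or nodes of that previous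
  -- layer (for the first gate layer V_2 the previous layer is V_1 itself,
  -- encoded by p = 0 and leaf children).

  data Leaf (n : ℕ) : Set a where
    var   : Fin n → Leaf n
    const : Carrier → Leaf n

  data Child (L p : ℕ) : Set where
    leaf : Fin L → Child L p
    prev : Fin p → Child L p

  data Op : Set where
    plus times : Op

  record Gate (L p : ℕ) : Set where
    constructor gate
    field
      op    : Op
      left  : Child L p
      right : Child L p

  data Layers (L : ℕ) : ℕ → Set where
    done : ∀ {p} → Layers L p
    next : ∀ {p k} → Vec (Gate L p) k → Layers L k → Layers L p

  record Circuit (n : ℕ) : Set a where
    constructor circuit
    field
      {L}    : ℕ
      leaves : Vec (Leaf n) L
      layers : Layers L 0

  sizeL : ∀ {L p} → Layers L p → ℕ
  sizeL done                  = 0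
  sizeL (next {k = k} _ rest) = k ℕ.+ sizeL rest

  widthL : ∀ {L p} → Layers L p → ℕ
  widthL done                  = 0
  widthL (next {k = k} _ rest) = k ℕ.⊔ widthL rest

  size : ∀ {n} → Circuit n → ℕ
  size (circuit {L} _ ls) = L ℕ.+ sizeL ls

  width : ∀ {n} → Circuit n → ℕ
  width (circuit _ ls) = widthL ls

  leafVal : ∀ {n} → Leaf n → Poly n
  leafVal (var i)   = varP i
  leafVal (const c) = constP c

  childVal : ∀ {n L p} → Vec (Poly n) L → Vec (Poly n) p → Child L p → Poly n
  childVal lv pv (leaf j) = lookup lv j
  childVal lv pv (prev u) = lookup pv u

  gateVal : ∀ {n L p} → Vec (Poly n) L → Vec (Poly n) p → Gate L p → Poly n
  gateVal lv pv (gate plus  l r) = addP  (childVal lv pv l) (childVal lv pv r)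
  gateVal lv pv (gate times l r) = mulP  (childVal lv pv l) (childVal lv pv r)

  layersVals : ∀ {n L p} → Vec (Poly n) L → Vec (Poly n) p → Layers L p → List (Poly n)
  layersVals lv pv done = []
  layersVals lv pv (next gs rest) =
    let vs = Vec.map (gateVal lv pv) gs in Vec.toList vs ++ layersVals lv vs rest

  nodeVals : ∀ {n} → Circuit n → List (Poly n)
  nodeVals (circuit lvs ls) =
    let lv = Vec.map leafVal lvs in Vec.toList lv ++ layersVals lv [] ls

  Computes : ∀ {n} → Circuit n → Poly n → Set _
  Computes C f = Any (λ g → g ≈ₚ f) (nodeVals C)

  IsOneLeaf : ∀ {n L} → Vec (Leaf n) L → Fin L → Set ℓ
  IsOneLeaf lvs j with lookup lvs j
  ... | var _   = Lift ℓ ⊥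
  ... | const c = c ≈ 1#

  IsTimesOne : ∀ {n L p} → Vec (Leaf n) L → Gate L p → Set ℓ
  IsTimesOne {L = L} {p} lvs g = Lift ℓ (Gate.op g ≡ times) × (
      (Σ (Fin p) λ u → Σ (Fin L) λ j →
         Lift ℓ ((Gate.left g ≡ prev u) × (Gate.right g ≡ leaf j)) × IsOneLeaf lvs j)
    ⊎ (Σ (Fin p) λ u → Σ (Fin L) λ j →
         Lift ℓ ((Gate.right g ≡ prev u) × (Gate.left g ≡ leaf j)) × IsOneLeaf lvs j))

  AllButOne : ∀ {b} {A : Set} → (A → Set b) → ∀ {k} → Vec A k → Set b
  AllButOne P gs = ∀ i j → ¬ (i ≡ j) → P (lookup gs i) ⊎ P (lookup gs j)

  StaggeredL : ∀ {n L p} → Vec (Leaf n) L → Layers L p → Set ℓ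
  StaggeredL lvs done           = Lift ℓ ⊤
  StaggeredL lvs (next gs rest) = AllButOne (IsTimesOne lvs) gs × StaggeredL lvs rest

  IsStaggered : ∀ {n} → Circuit n → Set ℓ
  IsStaggered (circuit lvs ls) = StaggeredL lvs ls

-- Since f(t x) = ∑_j t^j H_j(f)(x) and deg f ≤ m, solving the Vandermonde system
-- ∑_k c_k e_k^j = [j = i] (j ≤ m) for m+1 distinct field elements e_k gives
-- H_i(f)(x) = ∑_k c_k f(e_k x).  The new circuit re-evaluates, once for each e_k, the part
-- of the given circuit below the node computing f, with every variable x replaced by e_k x,
-- while an accumulator running alongside collects ∑_k c_k f(e_k x).  In a staggered layer
-- every gate but one is a copy u × 1, so only that gate reads variables: two extra layers
-- computing e_k x for its (at most two) variables suffice, and copies carry the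
-- accumulator and the previous layer along.  Each layer of the path thus becomes three
-- layers at most 3 wider, giving width w + O(1) and size O((s + m)²).

module Submission where

open import Defs
open import Level using (Level; lift; lower)
open import Data.Nat as ℕ using (ℕ; zero; suc; _∸_; _<_; _≤_; z≤n; s≤s)
import Data.Nat.Properties as ℕP
open import Data.Fin as Fin using (Fin; zero; suc; _↑ˡ_; _↑ʳ_)
import Data.Fin.Properties as FinP
open import Data.Vec as Vec using (Vec; []; _∷_; lookup)
import Data.Vec.Properties as VecP
open import Data.List as List using (List; []; _∷_; _++_; applyUpTo; upTo; concatMap)
import Data.List.Properties as ListP
open import Data.List.Relation.Unary.All as All using (All; []; _∷_)
import Data.List.Relation.Unary.All.Properties as AllP
open import Data.Product using (Σ; _×_; _,_; proj₁; proj₂)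
open import Data.Sum as Sum using (_⊎_; inj₁; inj₂)
open import Data.List.Relation.Unary.Any using (Any; here)
import Data.List.Relation.Unary.Any.Properties as AnyP
import Data.Vec.Relation.Unary.Any as VecAny
import Data.Vec.Relation.Unary.Any.Properties as VecAnyP
open import Data.Empty using (⊥-elim)
open import Data.Maybe using (Maybe; just; nothing)
open import Relation.Nullary using (¬_; yes; no)
open import Relation.Binary.Structures using (IsEquivalence)
open import Relation.Binary.Bundles using (Setoid)
open import Relation.Binary.PropositionalEquality as ≡ using (_≡_)
import Relation.Binary.Reasoning.Setoid as SetoidReasoning
open import Function using (_∘_; id; case_of_)
open import Data.Nat.Tactic.RingSolver using (solve-∀)

≤-by-slack : ∀ {x y} d → x ℕ.+ d ≡ y → x ≤ y
≤-by-slack d ≡.refl = ℕP.m≤m+n _ d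

allButOne-∷ : ∀ {a ℓ b} (F : Field a ℓ) {A : Set} {P : A → Set b} {k} (g : A) (gs : Vec A k) →
              (∀ u → P (lookup gs u)) → AllButOne F P (g ∷ gs)
allButOne-∷ F g gs tail zero    zero    0≢0 = ⊥-elim (0≢0 ≡.refl)
allButOne-∷ F g gs tail zero    (suc u) _   = inj₂ (tail u)
allButOne-∷ F g gs tail (suc u) _       _   = inj₁ (tail u)

module Sums {a ℓ : Level} (F : Field a ℓ) where
  open Field F hiding (zero)
  open SetoidReasoning setoid

  ∑ : List Carrier → Carrier
  ∑ = sumF F

  ∑-++ : ∀ xs ys → ∑ (xs ++ ys) ≈ ∑ xs + ∑ ys
  ∑-++ []       ys = sym (+-identityˡ _)
  ∑-++ (x ∷ xs) ys = trans (+-congˡ (∑-++ xs ys)) (sym (+-assoc _ _ _))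

  module _ {b : Level} {A : Set b} where

    ∑-map-cong : ∀ {g h : A → Carrier} {xs} → All (λ x → g x ≈ h x) xs →
                 ∑ (List.map g xs) ≈ ∑ (List.map h xs)
    ∑-map-cong []       = refl
    ∑-map-cong (e ∷ es) = +-cong e (∑-map-cong es)

    ∑-map-zero : ∀ {g : A → Carrier} {xs} → All (λ x → g x ≈ 0#) xs → ∑ (List.map g xs) ≈ 0#
    ∑-map-zero []       = refl
    ∑-map-zero (e ∷ es) = trans (+-cong e (∑-map-zero es)) (+-identityˡ 0#)

    ∑-map-*ˡ : ∀ c (g : A → Carrier) xs → ∑ (List.map (λ x → c * g x) xs) ≈ c * ∑ (List.map g xs)
    ∑-map-*ˡ c g []       = sym (zeroʳ c)
    ∑-map-*ˡ c g (x ∷ xs) = trans (+-congˡ (∑-map-*ˡ c g xs)) (sym (distribˡ c _ _))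

    ∑-map-concatMap : ∀ {B : Set b} (g : B → Carrier) (h : A → List B) xs →
      ∑ (List.map g (concatMap h xs)) ≈ ∑ (List.map (λ x → ∑ (List.map g (h x))) xs)
    ∑-map-concatMap g h []       = refl
    ∑-map-concatMap g h (x ∷ xs) = begin
      ∑ (List.map g (h x ++ concatMap h xs))
        ≡⟨ ≡.cong ∑ (ListP.map-++ g (h x) (concatMap h xs)) ⟩
      ∑ (List.map g (h x) ++ List.map g (concatMap h xs))
        ≈⟨ ∑-++ (List.map g (h x)) _ ⟩
      ∑ (List.map g (h x)) + ∑ (List.map g (concatMap h xs))
        ≈⟨ +-congˡ (∑-map-concatMap g h xs) ⟩
      ∑ (List.map g (h x)) + ∑ (List.map (λ x → ∑ (List.map g (h x))) xs) ∎

  ∑-applyUpTo-last : ∀ k (h : ℕ → Carrier) → (∀ b → b < k → h b ≈ 0#) → ∑ (applyUpTo h (suc k)) ≈ h k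
  ∑-applyUpTo-last zero    h vanish = +-identityʳ _
  ∑-applyUpTo-last (suc k) h vanish =
    trans (+-cong (vanish 0 (s≤s z≤n)) (∑-applyUpTo-last k (h ∘ suc) (λ b → vanish (suc b) ∘ s≤s)))
          (+-identityˡ _)

  ∑-map-upTo-last : ∀ k (h : ℕ → Carrier) → (∀ b → b < k → h b ≈ 0#) →
                    ∑ (List.map h (upTo (suc k))) ≈ h k
  ∑-map-upTo-last k h vanish = trans (reflexive (≡.cong ∑ (ListP.map-upTo h (suc k)))) (∑-applyUpTo-last k h vanish)

module Polynomials {a ℓ : Level} (F : Field a ℓ) where
  open Field F hiding (zero)
  open Sums F
  open import Algebra.Properties.Semiring.Exp semiring public using (_^_)
  open import Algebra.Properties.Semiring.Exp semiring using (^-homo-*)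
  open import Algebra.Properties.CommutativeSemigroup *-commutativeSemigroup using (interchange)
  open SetoidReasoning setoid

  infix 4 _≋_
  _≋_ : ∀ {n} → Poly F n → Poly F n → Set ℓ
  _≋_ = _≈ₚ_ F

  ≋-isEquivalence : ∀ {n} → IsEquivalence (_≋_ {n})
  ≋-isEquivalence = record
    { refl  = λ α → refl
    ; sym   = λ e α → sym (e α)
    ; trans = λ e e′ α → trans (e α) (e′ α)
    }

  ≋-setoid : ℕ → Setoid a ℓ
  ≋-setoid n = record { isEquivalence = ≋-isEquivalence {n} }

  module _ {n : ℕ} where
    open IsEquivalence (≋-isEquivalence {n}) public
      using () renaming (refl to ≋-refl; sym to ≋-sym; trans to ≋-trans; reflexive to ≡⇒≋)

  addP-cong : ∀ {n} {p p′ q q′ : Poly F n} → p ≋ p′ → q ≋ q′ →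
              addP F p q ≋ addP F p′ q′
  addP-cong e e′ α = +-cong (e α) (e′ α)

  mulP-cong : ∀ {n} {p p′ q q′ : Poly F n} → p ≋ p′ → q ≋ q′ →
              mulP F p q ≋ mulP F p′ q′
  mulP-cong e e′ α = ∑-map-cong (All.universal (λ (β , γ) → *-cong (e β) (e′ γ)) (splits F α))

  sum-replicate-0 : ∀ n → Vec.sum (Vec.replicate n 0) ≡ 0
  sum-replicate-0 zero    = ≡.refl
  sum-replicate-0 (suc n) = sum-replicate-0 n

  sum-unitVec : ∀ {n} (i : Fin n) → Vec.sum (unitVec F i) ≡ 1
  sum-unitVec {suc n} zero    = ≡.cong suc (sum-replicate-0 n)
  sum-unitVec {suc n} (suc i) = sum-unitVec i

  constP-0∷ : ∀ {n} c (γ : Monomial F n) → constP F c (0 ∷ γ) ≡ constP F c γ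
  constP-0∷ {n} c γ with VecP.≡-dec ℕ._≟_ (0 ∷ γ) (Vec.replicate (suc n) 0)
                       | VecP.≡-dec ℕ._≟_ γ (Vec.replicate n 0)
  ... | yes _  | yes _  = ≡.refl
  ... | yes e  | no ne  = ⊥-elim (ne (VecP.∷-injectiveʳ e))
  ... | no ne  | yes e  = ⊥-elim (ne (≡.cong (0 ∷_) e))
  ... | no _   | no _   = ≡.refl

  constP-suc∷ : ∀ {n} c x (γ : Monomial F n) → constP F c (suc x ∷ γ) ≡ 0#
  constP-suc∷ {n} c x γ with VecP.≡-dec ℕ._≟_ (suc x ∷ γ) (Vec.replicate (suc n) 0)
  ... | yes ()
  ... | no _ = ≡.refl

  -- Only the split (α , 0) contributes, and it sits at the last value b = k of the head.
  mulP-constʳ : ∀ {n} (p : Poly F n) c α → mulP F p (constP F c) α ≈ p α * c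
  mulP-constʳ p c []              = +-identityʳ _
  mulP-constʳ {suc n} p c (k ∷ α) = begin
    ∑ (List.map G (concatMap withHead (upTo (suc k))))
      ≈⟨ ∑-map-concatMap G withHead (upTo (suc k)) ⟩
    ∑ (List.map (λ b → ∑ (List.map G (withHead b))) (upTo (suc k)))
      ≈⟨ ∑-map-upTo-last k _ (λ b b<k → ∑-map-zero (AllP.map⁺ (All.universal (vanish b<k) (splits F α)))) ⟩
    ∑ (List.map G (withHead k))
      ≡⟨ ≡.cong ∑ (≡.sym (ListP.map-∘ (splits F α))) ⟩
    ∑ (List.map (G ∘ (λ (β , γ) → (k ∷ β , (k ∸ k) ∷ γ))) (splits F α))
      ≈⟨ ∑-map-cong {h = λ (β , γ) → p (k ∷ β) * constP F c γ}
                    (All.universal (λ (β , γ) → *-congˡ (reflexive (headless γ))) (splits F α)) ⟩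
    mulP F (λ β → p (k ∷ β)) (constP F c) α
      ≈⟨ mulP-constʳ (λ β → p (k ∷ β)) c α ⟩
    p (k ∷ α) * c ∎
    where
    G : Monomial F (suc n) × Monomial F (suc n) → Carrier
    G (β , γ) = p β * constP F c γ
    withHead : ℕ → List (Monomial F (suc n) × Monomial F (suc n))
    withHead b = List.map (λ (β , γ) → (b ∷ β , (k ∸ b) ∷ γ)) (splits F α)
    vanish : ∀ {b} → b < k → ∀ ((β , γ) : Monomial F n × Monomial F n) → G (b ∷ β , (k ∸ b) ∷ γ) ≈ 0#
    vanish {b} b<k (β , γ) with k ∸ b | ℕP.m<n⇒0<n∸m b<k
    ... | suc r | _ = trans (*-congˡ (reflexive (constP-suc∷ c r γ))) (zeroʳ _)
    headless : ∀ γ → constP F c ((k ∸ k) ∷ γ) ≡ constP F c γ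
    headless γ = ≡.trans (≡.cong (λ h → constP F c (h ∷ γ)) (ℕP.n∸n≡0 k)) (constP-0∷ c γ)

  constP-0# : ∀ {n} → constP F {n} 0# ≋ λ _ → 0#
  constP-0# {n} α with VecP.≡-dec ℕ._≟_ α (Vec.replicate n 0)
  ... | yes _ = refl
  ... | no _  = refl

  mulP-identityʳ : ∀ {n} (p : Poly F n) → mulP F p (constP F 1#) ≋ p
  mulP-identityʳ p α = trans (mulP-constʳ p 1# α) (*-identityʳ _)

  splits-degree : ∀ {n} (α : Monomial F n) →
    All (λ (β , γ) → Vec.sum β ℕ.+ Vec.sum γ ≡ Vec.sum α) (splits F α)
  splits-degree []      = ≡.refl ∷ []
  splits-degree (k ∷ α) =
    AllP.concat⁺ (AllP.map⁺ (AllP.applyUpTo⁺₁ id (suc k) λ b<1+k →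
      AllP.map⁺ (All.map (headDegree (ℕP.≤-pred b<1+k)) (splits-degree α))))
    where
    headDegree : ∀ {b x y z} → b ≤ k → x ℕ.+ y ≡ z → (b ℕ.+ x) ℕ.+ ((k ∸ b) ℕ.+ y) ≡ k ℕ.+ z
    headDegree {b} {x} {y} b≤k x+y≡z = ≡.trans (+-interchange b x (k ∸ b) y)
      (≡.cong₂ ℕ._+_ (ℕP.m+[n∸m]≡n b≤k) x+y≡z)
      where open import Algebra.Properties.CommutativeSemigroup ℕP.+-commutativeSemigroup
              using () renaming (interchange to +-interchange)

  -- scale t p is the polynomial x ↦ p (t x): the coefficient of x^α picks up t^|α|.
  scale : ∀ {n} → Carrier → Poly F n → Poly F n
  scale t p α = t ^ Vec.sum α * p α

  scale-addP : ∀ {n} t (p q : Poly F n) → addP F (scale t p) (scale t q) ≋ scale t (addP F p q)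
  scale-addP t p q α = sym (distribˡ _ _ _)

  scale-mulP : ∀ {n} t (p q : Poly F n) → mulP F (scale t p) (scale t q) ≋ scale t (mulP F p q)
  scale-mulP t p q α = begin
    ∑ (List.map (λ (β , γ) → (t ^ Vec.sum β * p β) * (t ^ Vec.sum γ * q γ)) (splits F α))
      ≈⟨ ∑-map-cong (All.map (λ {(β , γ)} → collect β γ) (splits-degree α)) ⟩
    ∑ (List.map (λ (β , γ) → t ^ Vec.sum α * (p β * q γ)) (splits F α))
      ≈⟨ ∑-map-*ˡ (t ^ Vec.sum α) (λ (β , γ) → p β * q γ) (splits F α) ⟩
    t ^ Vec.sum α * mulP F p q α ∎
    where
    collect : ∀ β γ → Vec.sum β ℕ.+ Vec.sum γ ≡ Vec.sum α →
      (t ^ Vec.sum β * p β) * (t ^ Vec.sum γ * q γ) ≈ t ^ Vec.sum α * (p β * q γ)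
    collect β γ degrees = trans (interchange _ _ _ _)
      (*-congʳ (trans (sym (^-homo-* t (Vec.sum β) (Vec.sum γ))) (reflexive (≡.cong (t ^_) degrees))))

  scale-constP : ∀ {n} t c → scale {n} t (constP F c) ≋ constP F c
  scale-constP {n} t c α with VecP.≡-dec ℕ._≟_ α (Vec.replicate n 0)
  ... | yes ≡.refl = trans (*-congʳ (reflexive (≡.cong (t ^_) (sum-replicate-0 n)))) (*-identityˡ c)
  ... | no _       = zeroʳ _

  scale-varP : ∀ {n} t (i : Fin n) → mulP F (varP F i) (constP F t) ≋ scale t (varP F i)
  scale-varP t i α = trans (mulP-constʳ (varP F i) t α) (coefficient α)
    where
    coefficient : ∀ α → varP F i α * t ≈ t ^ Vec.sum α * varP F i α
    coefficient α with VecP.≡-dec ℕ._≟_ α (unitVec F i)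
    ... | yes ≡.refl = trans (*-comm 1# t)
                         (*-congʳ (sym (trans (reflexive (≡.cong (t ^_) (sum-unitVec i))) (*-identityʳ t))))
    ... | no _       = trans (zeroˡ t) (sym (zeroʳ _))

module Interpolation {a ℓ : Level} (F : Field a ℓ) where
  open Field F hiding (zero)
  open Polynomials F using (_^_)
  open import Algebra.Properties.Group +-group using (//-rightDividesˡ; x∙y⁻¹≈ε⇒x≈y)
  open import Algebra.Properties.CommutativeSemigroup +-commutativeSemigroup
    using () renaming (interchange to +-interchange)
  open SetoidReasoning setoid

  Distinct : ∀ {N} → (Fin N → Carrier) → Set _
  Distinct e = ∀ i j → e i ≈ e j → i ≡ j

  powerSum : ∀ {N} → (Fin N → Carrier) → (Fin N → Carrier) → ℕ → Carrier
  powerSum {zero}  c e j = 0#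
  powerSum {suc N} c e j = c zero * e zero ^ j + powerSum (c ∘ suc) (e ∘ suc) j

  powerSum-cong : ∀ {N} {c c′ : Fin N → Carrier} e j → (∀ k → c k ≈ c′ k) →
                  powerSum c e j ≈ powerSum c′ e j
  powerSum-cong {zero}  e j c≈c′ = refl
  powerSum-cong {suc N} e j c≈c′ = +-cong (*-congʳ (c≈c′ zero)) (powerSum-cong (e ∘ suc) j (c≈c′ ∘ suc))

  powerSum-suc : ∀ {N} (c e : Fin N → Carrier) μ j →
    powerSum c e (suc j) ≈ μ * powerSum c e j + powerSum (λ k → c k * (e k + - μ)) e j
  powerSum-suc {zero}  c e μ j = sym (trans (+-identityʳ _) (zeroʳ μ))
  powerSum-suc {suc N} c e μ j = begin
    c zero * (e zero * e zero ^ j) + powerSum (c ∘ suc) (e ∘ suc) (suc j)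
      ≈⟨ +-cong (term (c zero) (e zero) (e zero ^ j)) (powerSum-suc (c ∘ suc) (e ∘ suc) μ j) ⟩
    (μ * (c zero * e zero ^ j) + _) + (μ * powerSum (c ∘ suc) (e ∘ suc) j + _)
      ≈⟨ +-interchange _ _ _ _ ⟩
    (μ * (c zero * e zero ^ j) + μ * powerSum (c ∘ suc) (e ∘ suc) j) + _
      ≈⟨ +-congʳ (sym (distribˡ μ _ _)) ⟩
    μ * powerSum c e j + powerSum (λ k → c k * (e k + - μ)) e j ∎
    where
    term : ∀ x y z → x * (y * z) ≈ μ * (x * z) + (x * (y + - μ)) * z
    term x y z = begin
      x * (y * z)                          ≈⟨ *-assoc x y z ⟨
      (x * y) * z                          ≈⟨ *-congʳ (*-congˡ (//-rightDividesˡ μ y)) ⟨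
      (x * ((y + - μ) + μ)) * z            ≈⟨ *-congʳ (distribˡ x _ μ) ⟩
      (x * (y + - μ) + x * μ) * z          ≈⟨ distribʳ z _ _ ⟩
      (x * (y + - μ)) * z + (x * μ) * z    ≈⟨ +-comm _ _ ⟩
      (x * μ) * z + (x * (y + - μ)) * z    ≈⟨ +-congʳ (trans (*-congʳ (*-comm x μ)) (*-assoc μ x z)) ⟩
      μ * (x * z) + (x * (y + - μ)) * z    ∎

  -- Transposed Vandermonde system: peel off the node μ = e 0, solve the differenced
  -- system b (j+1) − μ b j on the other nodes, and divide by the gaps e k − μ.
  vandermonde-solvable : ∀ {N} (e : Fin N → Carrier) → Distinct e → (b : ℕ → Carrier) →
    Σ (Fin N → Carrier) λ c → ∀ j → j < N → powerSum c e j ≈ b j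
  vandermonde-solvable {zero}  e distinct b = (λ ()) , λ _ ()
  vandermonde-solvable {suc N} e distinct b = c , solves
    where
    μ : Carrier
    μ = e zero
    e′ : Fin N → Carrier
    e′ = e ∘ suc
    gap-nonzero : ∀ k → ¬ (e′ k + - μ ≈ 0#)
    gap-nonzero k gap≈0 with distinct (suc k) zero (x∙y⁻¹≈ε⇒x≈y _ _ gap≈0)
    ... | ()
    gap⁻¹ : Fin N → Carrier
    gap⁻¹ k = proj₁ (inverse _ (gap-nonzero k))
    d : ℕ → Carrier
    d j = b (suc j) + - (μ * b j)
    smaller : Σ (Fin N → Carrier) λ c → ∀ j → j < N → powerSum c e′ j ≈ d j
    smaller = vandermonde-solvable e′ (λ i j eq → FinP.suc-injective (distinct (suc i) (suc j) eq)) d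
    c′ : Fin N → Carrier
    c′ k = proj₁ smaller k * gap⁻¹ k
    M : ℕ → Carrier
    M = powerSum c′ e′
    c : Fin (suc N) → Carrier
    c zero    = b 0 + - M 0
    c (suc k) = c′ k
    M-suc : ∀ j → j < N → M (suc j) ≈ μ * M j + d j
    M-suc j j<N = trans (powerSum-suc c′ e′ μ j) (+-congˡ (trans (powerSum-cong e′ j cancel) (proj₂ smaller j j<N)))
      where
      cancel : ∀ k → c′ k * (e′ k + - μ) ≈ proj₁ smaller k
      cancel k = trans (*-assoc _ _ _) (trans (*-congˡ (trans (*-comm _ _) (proj₂ (inverse _ (gap-nonzero k)))))
                                              (*-identityʳ _))
    solves : ∀ j → j < suc N → powerSum c e j ≈ b j
    solves zero    _         = trans (+-congʳ (*-identityʳ _)) (//-rightDividesˡ (M 0) (b 0))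
    solves (suc j) (s≤s j<N) = begin
      c zero * (μ * μ ^ j) + M (suc j)      ≈⟨ +-cong (x[yz]≈y[xz] (c zero) μ (μ ^ j)) (M-suc j j<N) ⟩
      μ * (c zero * μ ^ j) + (μ * M j + d j) ≈⟨ +-assoc _ _ _ ⟨
      (μ * (c zero * μ ^ j) + μ * M j) + d j ≈⟨ +-congʳ (distribˡ μ _ _) ⟨
      μ * powerSum c e j + d j               ≈⟨ +-congʳ (*-congˡ (solves j (ℕP.m≤n⇒m≤1+n j<N))) ⟩
      μ * b j + (b (suc j) + - (μ * b j))    ≈⟨ +-comm _ _ ⟩
      (b (suc j) + - (μ * b j)) + μ * b j    ≈⟨ //-rightDividesˡ (μ * b j) (b (suc j)) ⟩
      b (suc j)                              ∎
      where
      x[yz]≈y[xz] : ∀ x y z → x * (y * z) ≈ y * (x * z)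
      x[yz]≈y[xz] x y z = trans (sym (*-assoc x y z)) (trans (*-congʳ (*-comm x y)) (*-assoc y x z))

module HomogeneousComponents {a ℓ : Level} (F : Field a ℓ) where
  open Field F hiding (zero)
  open Polynomials F
  open Interpolation F
  open SetoidReasoning setoid

  weightedScalings : ∀ {N n} → (Fin N → Carrier) → (Fin N → Carrier) → Poly F n → Poly F n
  weightedScalings {zero}  e c f α = 0#
  weightedScalings {suc N} e c f α = scale (e zero) f α * c zero + weightedScalings (e ∘ suc) (c ∘ suc) f α

  weightedScalings-coefficient : ∀ {N n} (e c : Fin N → Carrier) (f : Poly F n) α →
    weightedScalings e c f α ≈ f α * powerSum c e (Vec.sum α)
  weightedScalings-coefficient {zero}  e c f α = sym (zeroʳ _)
  weightedScalings-coefficient {suc N} e c f α =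
    trans (+-cong head (weightedScalings-coefficient (e ∘ suc) (c ∘ suc) f α)) (sym (distribˡ _ _ _))
    where
    head : (e zero ^ Vec.sum α * f α) * c zero ≈ f α * (c zero * e zero ^ Vec.sum α)
    head = trans (*-congʳ (*-comm _ _)) (trans (*-assoc _ _ _) (*-congˡ (*-comm _ _)))

  weightedScalings-cong : ∀ {N n} (e c : Fin N → Carrier) {f g : Poly F n} → f ≋ g →
                          weightedScalings e c f ≋ weightedScalings e c g
  weightedScalings-cong {zero}  e c f≋g α = refl
  weightedScalings-cong {suc N} e c f≋g α =
    +-cong (*-congʳ (*-congˡ (f≋g α))) (weightedScalings-cong (e ∘ suc) (c ∘ suc) f≋g α)

  indicator : ℕ → ℕ → Carrier
  indicator i j with j ℕ.≟ i
  ... | yes _ = 1#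
  ... | no _  = 0#

  H-coefficient : ∀ {n} i (f : Poly F n) α → H F i f α ≈ f α * indicator i (Vec.sum α)
  H-coefficient i f α with Vec.sum α ℕ.≟ i
  ... | yes _ = sym (*-identityʳ _)
  ... | no _  = sym (zeroʳ _)

  H-as-weightedScalings : ∀ {n m} (f : Poly F n) → HasDegree F f m →
    (e : Fin (suc m) → Carrier) → Distinct e → ∀ i →
    Σ (Fin (suc m) → Carrier) λ c → H F i f ≋ weightedScalings e c f
  H-as-weightedScalings {m = m} f (vanishes-above-m , _) e distinct i = c , λ α →
    trans (H-coefficient i f α) (trans (agree α) (sym (weightedScalings-coefficient e c f α)))
    where
    interpolant : Σ (Fin (suc m) → Carrier) λ c → ∀ j → j < suc m → powerSum c e j ≈ indicator i j
    interpolant = vandermonde-solvable e distinct (indicator i)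
    c : Fin (suc m) → Carrier
    c = proj₁ interpolant
    agree : ∀ α → f α * indicator i (Vec.sum α) ≈ f α * powerSum c e (Vec.sum α)
    agree α with Vec.sum α ℕ.<? suc m
    ... | yes |α|≤m = *-congˡ (sym (proj₂ interpolant _ |α|≤m))
    ... | no  |α|>m = trans (*-congʳ f≈0) (trans (zeroˡ _) (sym (trans (*-congʳ f≈0) (zeroˡ _))))
      where
      f≈0 : f α ≈ 0#
      f≈0 = vanishes-above-m α (ℕP.≮⇒≥ |α|>m)

module Paths {a ℓ : Level} (F : Field a ℓ) {n : ℕ} where
  open Field F hiding (zero)
  open Polynomials F

  Vals : ℕ → Set a
  Vals = Vec (Poly F n)

  leafVals : ∀ {L} → Vec (Leaf F n) L → Vals L
  leafVals = Vec.map (leafVal F)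

  lookup-leafVals : ∀ {L} (lvs : Vec (Leaf F n) L) j → lookup (leafVals lvs) j ≡ leafVal F (lookup lvs j)
  lookup-leafVals lvs j = VecP.lookup-map j (leafVal F) lvs

  leafVals-≡ : ∀ {L L′} (lvs : Vec (Leaf F n) L) (lvs′ : Vec (Leaf F n) L′) {j j′} →
               lookup lvs′ j′ ≡ lookup lvs j → lookup (leafVals lvs′) j′ ≡ lookup (leafVals lvs) j
  leafVals-≡ lvs lvs′ {j} {j′} eq =
    ≡.trans (lookup-leafVals lvs′ j′) (≡.trans (≡.cong (leafVal F) eq) (≡.sym (lookup-leafVals lvs j)))

  layerVals : ∀ {L p k} → Vals L → Vals p → Vec (Gate F L p) k → Vals k
  layerVals lv pv = Vec.map (gateVal F lv pv)

  lookup-layerVals : ∀ {L p k} (lv : Vals L) (pv : Vals p) (gs : Vec (Gate F L p) k) s →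
                     lookup (layerVals lv pv gs) s ≡ gateVal F lv pv (lookup gs s)
  lookup-layerVals lv pv gs s = VecP.lookup-map s (gateVal F lv pv) gs

  -- The layers of a path are nonempty, so their number is bounded by pathSize.
  data Path (L : ℕ) : ℕ → Set where
    end  : ∀ {p k} → Vec (Gate F L p) k → Fin k → Path L p
    step : ∀ {p k} → Vec (Gate F L p) (suc k) → Path L (suc k) → Path L p

  pathVal : ∀ {L p} → Vals L → Vals p → Path L p → Poly F n
  pathVal lv pv (end gs t)  = gateVal F lv pv (lookup gs t)
  pathVal lv pv (step gs P) = pathVal lv (layerVals lv pv gs) P

  StaggeredPath : ∀ {L p} → Vec (Leaf F n) L → Path L p → Set ℓ
  StaggeredPath lvs (end gs t)  = AllButOne F (IsTimesOne F lvs) gs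
  StaggeredPath lvs (step gs P) = AllButOne F (IsTimesOne F lvs) gs × StaggeredPath lvs P

  pathSize : ∀ {L p} → Path L p → ℕ
  pathSize (end {k = k} gs t)  = k
  pathSize (step {k = k} gs P) = suc k ℕ.+ pathSize P

  PathWidth≤ : ∀ {L p} → ℕ → Path L p → Set
  PathWidth≤ W (end {k = k} gs t)  = k ≤ W
  PathWidth≤ W (step {k = k} gs P) = suc k ≤ W × PathWidth≤ W P

  PathWidth≤-mono : ∀ {L p} (P : Path L p) {W W′} → W ≤ W′ → PathWidth≤ W P → PathWidth≤ W′ P
  PathWidth≤-mono (end gs t)  W≤W′ k≤W        = ℕP.≤-trans k≤W W≤W′
  PathWidth≤-mono (step gs P) W≤W′ (k≤W , P≤W) = ℕP.≤-trans k≤W W≤W′ , PathWidth≤-mono P W≤W′ P≤W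

  record PathTo {L p} (lvs : Vec (Leaf F n) L) (pv : Vals p) (f : Poly F n) (S W : ℕ) : Set ℓ where
    field
      path      : Path L p
      staggered : StaggeredPath lvs path
      computes  : pathVal (leafVals lvs) pv path ≋ f
      size≤     : pathSize path ≤ S
      width≤    : PathWidth≤ W path

  weaken : ∀ {L p} {lvs : Vec (Leaf F n) L} {pv : Vals p} {f S S′ W W′} → S ≤ S′ → W ≤ W′ →
           PathTo lvs pv f S W → PathTo lvs pv f S′ W′
  weaken S≤S′ W≤W′ π = record
    { path      = path
    ; staggered = staggered
    ; computes  = computes
    ; size≤     = ℕP.≤-trans size≤ S≤S′
    ; width≤    = PathWidth≤-mono path W≤W′ width≤
    }
    where open PathTo π

  -- An empty layer cuts all dependence on the layers below it, so the path restarts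
  -- there (with no previous layer); this is the right-hand alternative.
  pathTo-layers : ∀ {L p} (lvs : Vec (Leaf F n) L) {f} (pv : Vals p) (ls : Layers F L p) →
    StaggeredL F lvs ls → Any (λ g → g ≋ f) (layersVals F (leafVals lvs) pv ls) →
    PathTo lvs pv f (sizeL F ls) (widthL F ls) ⊎ PathTo lvs [] f (sizeL F ls) (widthL F ls)
  pathTo-layers lvs {f} pv (next {k = k} gs rest) (staggered , rest-staggered) found
    with AnyP.++⁻ (Vec.toList (layerVals (leafVals lvs) pv gs)) found
  ... | inj₁ inLayer = inj₁ record
    { path      = end gs t
    ; staggered = staggered
    ; computes  = ≋-trans (≡⇒≋ (≡.sym (lookup-layerVals (leafVals lvs) pv gs t))) (VecAnyP.lookup-index found-at-t)
    ; size≤     = ℕP.m≤m+n k _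
    ; width≤    = ℕP.m≤m⊔n k _
    }
    where
    found-at-t : VecAny.Any (_≋ f) (layerVals (leafVals lvs) pv gs)
    found-at-t = VecAnyP.toList⁻ inLayer
    t : Fin k
    t = VecAny.index found-at-t
  pathTo-layers lvs pv (next {k = zero} [] rest) (_ , rest-staggered) found | inj₂ above =
    inj₂ (Sum.reduce (pathTo-layers lvs [] rest rest-staggered above))
  pathTo-layers lvs pv (next {k = suc k} gs rest) (layer-staggered , rest-staggered) found | inj₂ above
    with pathTo-layers lvs (layerVals (leafVals lvs) pv gs) rest rest-staggered above
  ... | inj₁ π = inj₁ record
    { path      = step gs path
    ; staggered = layer-staggered , staggered
    ; computes  = computes
    ; size≤     = s≤s (ℕP.+-monoʳ-≤ k size≤)
    ; width≤    = ℕP.m≤m⊔n (suc k) (widthL F rest) , PathWidth≤-mono path (ℕP.m≤n⊔m (suc k) _) width≤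
    }
    where open PathTo π
  ... | inj₂ π = inj₂ (weaken (ℕP.m≤n+m _ (suc k)) (ℕP.m≤n⊔m (suc k) _) π)

  pathTo-gate : ∀ {L} (lvs : Vec (Leaf F n) L) {f} (ls : Layers F L 0) → StaggeredL F lvs ls →
    Any (_≋ f) (layersVals F (leafVals lvs) [] ls) → PathTo lvs [] f (sizeL F ls) (widthL F ls)
  pathTo-gate lvs ls staggered found = Sum.reduce (pathTo-layers lvs [] ls staggered found)

  leaf-or-gate : ∀ {L} (lvs : Vec (Leaf F n) L) (ls : Layers F L 0) {f} → Computes F (circuit lvs ls) f →
    (Σ (Fin L) λ j → lookup (leafVals lvs) j ≋ f) ⊎ Any (_≋ f) (layersVals F (leafVals lvs) [] ls)
  leaf-or-gate lvs ls found = Sum.map₁ (λ atLeaf → let found-j = VecAnyP.toList⁻ atLeaf in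
                                          VecAny.index found-j , VecAnyP.lookup-index found-j)
                                       (AnyP.++⁻ (Vec.toList (leafVals lvs)) found)

module FirstJust where

  firstJust : ∀ {A : Set} {k} → Vec (Maybe A) k → Maybe A
  firstJust []             = nothing
  firstJust (just x ∷ xs)  = just x
  firstJust (nothing ∷ xs) = firstJust xs

  firstJust-found : ∀ {A : Set} {k} (xs : Vec (Maybe A) k) t {x} → lookup xs t ≡ just x →
    Σ (Fin k) λ t′ → Σ A λ x′ → firstJust xs ≡ just x′ × lookup xs t′ ≡ just x′
  firstJust-found (just y ∷ xs)  t       _  = zero , y , ≡.refl , ≡.refl
  firstJust-found (nothing ∷ xs) (suc t) eq with firstJust-found xs t eq
  ... | t′ , x′ , first , at-t′ = suc t′ , x′ , first , at-t′

module ConstLeaves {a ℓ : Level} (F : Field a ℓ) {n : ℕ} {L′ : ℕ} (lvs′ : Vec (Leaf F n) L′) where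
  open Field F hiding (zero)
  open Paths F {n}

  record ConstLeaf (x : Carrier) : Set a where
    constructor constLeaf
    field
      index    : Fin L′
      is-const : lookup lvs′ index ≡ const x
  open ConstLeaf public

  lv′ : Vals L′
  lv′ = leafVals lvs′

  constLeaf-val : ∀ {x} (j : ConstLeaf x) → lookup lv′ (index j) ≡ constP F x
  constLeaf-val (constLeaf j eq) = ≡.trans (lookup-leafVals lvs′ j) (≡.cong (leafVal F) eq)

  constLeaf-isOne : ∀ {x} (j : ConstLeaf x) → x ≈ 1# → IsOneLeaf F lvs′ (index j)
  constLeaf-isOne (constLeaf j eq) x≈1 rewrite eq = x≈1

  record WeightedNode : Set a where
    field
      {node weight} : Carrier
      nodeLeaf      : ConstLeaf node
      weightLeaf    : ConstLeaf weight
  open WeightedNode public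

module Construction {a ℓ : Level} (F : Field a ℓ) {n : ℕ} {L′ : ℕ} (lvs′ : Vec (Leaf F n) L′)
                    (one : ConstLeaves.ConstLeaf F lvs′ (Field.1# F)) where
  open Field F hiding (zero)
  open Polynomials F
  open Paths F {n}
  open ConstLeaves F lvs′

  copy : ∀ {q} → Fin q → Gate F L′ q
  copy u = gate times (prev u) (leaf (index one))

  copies : ∀ q → Vec (Gate F L′ q) q
  copies q = Vec.tabulate copy

  copy-isTimesOne : ∀ {q} (u : Fin q) → IsTimesOne F lvs′ (copy u)
  copy-isTimesOne u = lift ≡.refl , inj₁ (u , index one , lift (≡.refl , ≡.refl) , constLeaf-isOne one refl)

  copy-val : ∀ {q} (pv : Vals q) u → gateVal F lv′ pv (copy u) ≋ lookup pv u
  copy-val pv u = ≋-trans (mulP-cong ≋-refl (≡⇒≋ (constLeaf-val one))) (mulP-identityʳ (lookup pv u))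

  copies-val : ∀ {q} (pv : Vals q) u → lookup (layerVals lv′ pv (copies q)) u ≋ lookup pv u
  copies-val pv u = ≋-trans (≡⇒≋ (≡.trans (VecP.lookup-map u (gateVal F lv′ pv) (copies _))
                                            (≡.cong (gateVal F lv′ pv) (VecP.lookup∘tabulate copy u))))
                             (copy-val pv u)

  copies-isTimesOne : ∀ q (u : Fin q) → IsTimesOne F lvs′ (lookup (copies q) u)
  copies-isTimesOne q u = ≡.subst (IsTimesOne F lvs′) (≡.sym (VecP.lookup∘tabulate copy u)) (copy-isTimesOne u)

  timesOneTail-staggered : ∀ {q k} (g : Gate F L′ q) (gs : Vec (Gate F L′ q) k) →
    (∀ u → IsTimesOne F lvs′ (lookup gs u)) → AllButOne F (IsTimesOne F lvs′) (g ∷ gs)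
  timesOneTail-staggered = allButOne-∷ F {P = IsTimesOne F lvs′}

  before-copies-staggered : ∀ {q} (g : Gate F L′ q) → AllButOne F (IsTimesOne F lvs′) (g ∷ copies q)
  before-copies-staggered g = timesOneTail-staggered g (copies _) (copies-isTimesOne _)

  -- What follows an embedded path, given the position of its selected gate.
  Cont : Set
  Cont = ∀ {k} → Fin k → Layers F L′ (suc k)

  module Embedded {LP : ℕ} (lvs : Vec (Leaf F n) LP) (ι : Fin LP → Fin L′)
                  (ι-lookup : ∀ j → lookup lvs′ (ι j) ≡ lookup lvs j) where
    open FirstJust

    lv : Vals LP
    lv = leafVals lvs

    isVar : Leaf F n → Fin LP → Maybe (Fin LP)
    isVar (var _)   j = just j
    isVar (const _) j = nothing

    varChild : ∀ {p} → Child F LP p → Maybe (Fin LP)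
    varChild (leaf j) = isVar (lookup lvs j) j
    varChild (prev _) = nothing

    varChild-leaf : ∀ {p} {ch : Child F LP p} {j x} → ch ≡ leaf j → lookup lvs j ≡ var x → varChild ch ≡ just j
    varChild-leaf ≡.refl eq rewrite eq = ≡.refl

    isVar-notOne : ∀ j₀ {j} → isVar (lookup lvs j₀) j₀ ≡ just j → ¬ IsOneLeaf F lvs j₀
    isVar-notOne j₀ isVar isOne with lookup lvs j₀
    ... | var _   = lower isOne
    ... | const _ with () ← isVar

    leftVar-notTimesOne : ∀ {p} (g : Gate F LP p) {j} → varChild (Gate.left g) ≡ just j → ¬ IsTimesOne F lvs g
    leftVar-notTimesOne (gate o (prev _) r) ()
    leftVar-notTimesOne (gate o (leaf j₀) r) isVar (_ , inj₁ (_ , _ , lift (() , _) , _))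
    leftVar-notTimesOne (gate o (leaf j₀) r) isVar (_ , inj₂ (_ , _ , lift (_ , ≡.refl) , isOne)) =
      isVar-notOne j₀ isVar isOne

    rightVar-notTimesOne : ∀ {p} (g : Gate F LP p) {j} → varChild (Gate.right g) ≡ just j → ¬ IsTimesOne F lvs g
    rightVar-notTimesOne (gate o l (prev _)) ()
    rightVar-notTimesOne (gate o l (leaf j₀)) isVar (_ , inj₂ (_ , _ , lift (() , _) , _))
    rightVar-notTimesOne (gate o l (leaf j₀)) isVar (_ , inj₁ (_ , _ , lift (_ , ≡.refl) , isOne)) =
      isVar-notOne j₀ isVar isOne

    firstVar : ∀ {p k} → (Gate F LP p → Child F LP p) → Vec (Gate F LP p) k → Maybe (Fin LP)
    firstVar side gs = firstJust (Vec.map (varChild ∘ side) gs)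

    -- A gate with a variable child is not of the form u × 1, so in a staggered layer
    -- it is the only one; hence the first variable found on that side is its child.
    firstVar-unique : ∀ {p k} (side : Gate F LP p → Child F LP p) →
      (∀ g {j} → varChild (side g) ≡ just j → ¬ IsTimesOne F lvs g) →
      (gs : Vec (Gate F LP p) k) → AllButOne F (IsTimesOne F lvs) gs →
      ∀ s {j} → varChild (side (lookup gs s)) ≡ just j → firstVar side gs ≡ just j
    firstVar-unique side notTimesOne gs staggered s {j} isVar
      with firstJust-found (Vec.map (varChild ∘ side) gs) s (≡.trans (VecP.lookup-map s _ gs) isVar)
    ... | s′ , j′ , first , at-s′ with s′ Fin.≟ s
    ...   | yes ≡.refl = ≡.trans first (≡.trans (≡.sym at-s′) (≡.trans (VecP.lookup-map s _ gs) isVar))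
    ...   | no s′≢s with staggered s′ s s′≢s
    ...     | inj₁ timesOne =
      ⊥-elim (notTimesOne (lookup gs s′) (≡.trans (≡.sym (VecP.lookup-map s′ _ gs)) at-s′) timesOne)
    ...     | inj₂ timesOne = ⊥-elim (notTimesOne (lookup gs s) isVar timesOne)

    -- Children of an embedded gate read the layer below as follows: position 0 holds the
    -- scaled right variable, 1 the scaled left variable, 2 the accumulator and 3 + u the
    -- scaled node u of the previous layer of the path.
    embedLeaf : ∀ {q} → Leaf F n → Fin LP → Fin q → Child F L′ q
    embedLeaf (var _)   j h = prev h
    embedLeaf (const _) j h = leaf (ι j)

    embedChild : ∀ {p} → Fin (3 ℕ.+ p) → Child F LP p → Child F L′ (3 ℕ.+ p)
    embedChild h (leaf j) = embedLeaf (lookup lvs j) j h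
    embedChild h (prev u) = prev (suc (suc (suc u)))

    embedGate : ∀ {p} → Gate F LP p → Gate F L′ (3 ℕ.+ p)
    embedGate (gate o l r) = gate o (embedChild (suc zero) l) (embedChild zero r)

    oneLeaf-embeds : ∀ {q} j (h : Fin q) → IsOneLeaf F lvs j →
                     embedLeaf (lookup lvs j) j h ≡ leaf (ι j) × IsOneLeaf F lvs′ (ι j)
    oneLeaf-embeds j h isOne with lookup lvs j in eq
    ... | var _   = ⊥-elim (lower isOne)
    ... | const c = ≡.refl , constLeaf-isOne (constLeaf (ι j) (≡.trans (ι-lookup j) eq)) isOne

    embedGate-isTimesOne : ∀ {p} (g : Gate F LP p) → IsTimesOne F lvs g → IsTimesOne F lvs′ (embedGate g)
    embedGate-isTimesOne (gate o (prev u) (leaf j)) (isTimes , inj₁ (_ , _ , lift (≡.refl , ≡.refl) , isOne)) =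
      let embeds , isOne′ = oneLeaf-embeds j zero isOne
      in isTimes , inj₁ (suc (suc (suc u)) , ι j , lift (≡.refl , embeds) , isOne′)
    embedGate-isTimesOne (gate o (leaf j) (prev u)) (isTimes , inj₂ (_ , _ , lift (≡.refl , ≡.refl) , isOne)) =
      let embeds , isOne′ = oneLeaf-embeds j (suc zero) isOne
      in isTimes , inj₂ (suc (suc (suc u)) , ι j , lift (≡.refl , embeds) , isOne′)

    module Scaled {t : Carrier} (tLeaf : ConstLeaf t) where

      scaledVar : ∀ {q} → Maybe (Fin LP) → Gate F L′ q
      scaledVar (just j) = gate times (leaf (ι j)) (leaf (index tLeaf))
      scaledVar nothing  = gate times (leaf (index one)) (leaf (index one))

      scaledVar-val : ∀ {q} (pv : Vals q) {m j x} → m ≡ just j → lookup lvs j ≡ var x →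
                      gateVal F lv′ pv (scaledVar m) ≋ scale t (varP F x)
      scaledVar-val pv {j = j} ≡.refl eq = ≋-trans
        (mulP-cong (≡⇒≋ (≡.trans (lookup-leafVals lvs′ (ι j)) (≡.cong (leafVal F) (≡.trans (ι-lookup j) eq))))
                   (≡⇒≋ (constLeaf-val tLeaf)))
        (scale-varP t _)

      -- A path layer becomes three: layers A and B compute t x for the variables read by
      -- the layer's one non-copy gate, layer C evaluates the embedded gates.
      layerA : ∀ {p k} → Vec (Gate F LP p) k → Vec (Gate F L′ (suc p)) (2 ℕ.+ p)
      layerA gs = scaledVar (firstVar Gate.left gs) ∷ copies _

      layerB : ∀ {p k} → Vec (Gate F LP p) k → Vec (Gate F L′ (2 ℕ.+ p)) (3 ℕ.+ p)
      layerB gs = scaledVar (firstVar Gate.right gs) ∷ copies _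

      layerC : ∀ {p k} → Vec (Gate F LP p) k → Vec (Gate F L′ (3 ℕ.+ p)) (suc k)
      layerC gs = copy (suc (suc zero)) ∷ Vec.map embedGate gs

      block : ∀ {p k} → Vec (Gate F LP p) k → Layers F L′ (suc k) → Layers F L′ (suc p)
      block gs rest = next (layerA gs) (next (layerB gs) (next (layerC gs) rest))

      run : ∀ {p} → Path LP p → Cont → Layers F L′ (suc p)
      run (end gs s)  κ = block gs (κ s)
      run (step gs P) κ = block gs (run P κ)

      layerC-staggered : ∀ {p k} (gs : Vec (Gate F LP p) k) → AllButOne F (IsTimesOne F lvs) gs →
                         AllButOne F (IsTimesOne F lvs′) (layerC gs)
      layerC-staggered gs staggered zero    _       _   = inj₁ (copy-isTimesOne _)
      layerC-staggered gs staggered (suc s) zero    _   = inj₂ (copy-isTimesOne _)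
      layerC-staggered gs staggered (suc s) (suc s′) s≢s′ =
        Sum.map (embedded s) (embedded s′) (staggered s s′ (s≢s′ ∘ ≡.cong suc))
        where
        embedded : ∀ s → IsTimesOne F lvs (lookup gs s) → IsTimesOne F lvs′ (lookup (Vec.map embedGate gs) s)
        embedded s = ≡.subst (IsTimesOne F lvs′) (≡.sym (VecP.lookup-map s embedGate gs)) ∘ embedGate-isTimesOne _

      run-staggered : ∀ {p} (P : Path LP p) (κ : Cont) → StaggeredPath lvs P →
        (∀ {k} (s : Fin k) → StaggeredL F lvs′ (κ s)) → StaggeredL F lvs′ (run P κ)
      run-staggered (end gs s) κ staggered κ-staggered =
        before-copies-staggered _ , before-copies-staggered _ , layerC-staggered gs staggered , κ-staggered s
      run-staggered (step gs P) κ (staggered , P-staggered) κ-staggered =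
        before-copies-staggered _ , before-copies-staggered _ , layerC-staggered gs staggered ,
        run-staggered P κ P-staggered κ-staggered

      ScaledPrev : ∀ {p} → Vals p → Vals (3 ℕ.+ p) → Set ℓ
      ScaledPrev pv pvB = ∀ u → lookup pvB (suc (suc (suc u))) ≋ scale t (lookup pv u)

      ScaledVarAt : ∀ {p q} → Vals q → Fin q → Child F LP p → Set (a Level.⊔ ℓ)
      ScaledVarAt pvB h ch = ∀ {j x} → ch ≡ leaf j → lookup lvs j ≡ var x → lookup pvB h ≋ scale t (varP F x)

      embedChild-val : ∀ {p} (pv : Vals p) (pvB : Vals (3 ℕ.+ p)) h ch →
        ScaledPrev pv pvB → ScaledVarAt pvB h ch → childVal F lv′ pvB (embedChild h ch) ≋ scale t (childVal F lv pv ch)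
      embedChild-val pv pvB h (prev u) scaledPrev scaledVar = scaledPrev u
      embedChild-val pv pvB h (leaf j) scaledPrev scaledVar =
        ≋-trans (embedLeaf-val (lookup lvs j) ≡.refl) (≡⇒≋ (≡.cong (scale t) (≡.sym (lookup-leafVals lvs j))))
        where
        embedLeaf-val : ∀ l → lookup lvs j ≡ l → childVal F lv′ pvB (embedLeaf l j h) ≋ scale t (leafVal F l)
        embedLeaf-val (var x)   eq = scaledVar ≡.refl eq
        embedLeaf-val (const c) eq = ≋-trans (≡⇒≋ (constLeaf-val (constLeaf (ι j) (≡.trans (ι-lookup j) eq))))
                                             (≋-sym (scale-constP t c))

      embedGate-val : ∀ {p} (pv : Vals p) (pvB : Vals (3 ℕ.+ p)) g → ScaledPrev pv pvB →
        ScaledVarAt pvB (suc zero) (Gate.left g) → ScaledVarAt pvB zero (Gate.right g) →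
        gateVal F lv′ pvB (embedGate g) ≋ scale t (gateVal F lv pv g)
      embedGate-val pv pvB (gate plus  l r) scaledPrev left right =
        ≋-trans (addP-cong (embedChild-val pv pvB _ l scaledPrev left) (embedChild-val pv pvB _ r scaledPrev right))
                (scale-addP t _ _)
      embedGate-val pv pvB (gate times l r) scaledPrev left right =
        ≋-trans (mulP-cong (embedChild-val pv pvB _ l scaledPrev left) (embedChild-val pv pvB _ r scaledPrev right))
                (scale-mulP t _ _)

      Tracks : ∀ {p} → Poly F n → Vals p → Vals (suc p) → Set ℓ
      Tracks acc pv pv′ = lookup pv′ zero ≋ acc × (∀ u → lookup pv′ (suc u) ≋ scale t (lookup pv u))

      valsA : ∀ {p k} → Vec (Gate F LP p) k → Vals (suc p) → Vals (2 ℕ.+ p)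
      valsA gs pv′ = layerVals lv′ pv′ (layerA gs)

      valsB : ∀ {p k} → Vec (Gate F LP p) k → Vals (suc p) → Vals (3 ℕ.+ p)
      valsB gs pv′ = layerVals lv′ (valsA gs pv′) (layerB gs)

      valsC : ∀ {p k} → Vec (Gate F LP p) k → Vals (suc p) → Vals (suc k)
      valsC gs pv′ = layerVals lv′ (valsB gs pv′) (layerC gs)

      block-tracks : ∀ {p k} (gs : Vec (Gate F LP p) k) → AllButOne F (IsTimesOne F lvs) gs →
        ∀ {acc pv pv′} → Tracks acc pv pv′ → Tracks acc (layerVals lv pv gs) (valsC gs pv′)
      block-tracks {p} gs staggered {acc} {pv} {pv′} (acc-at-0 , scaled) = acc-kept , embedded
        where
        vA : Vals (2 ℕ.+ p)
        vA = valsA gs pv′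
        vB : Vals (3 ℕ.+ p)
        vB = valsB gs pv′
        acc-kept : lookup (valsC gs pv′) zero ≋ acc
        acc-kept = ≋-trans (copy-val vB (suc (suc zero)))
                     (≋-trans (copies-val vA (suc zero)) (≋-trans (copies-val pv′ zero) acc-at-0))
        prev-scaled : ScaledPrev pv vB
        prev-scaled u = ≋-trans (copies-val vA (suc (suc u))) (≋-trans (copies-val pv′ (suc u)) (scaled u))
        left-scaled : ∀ s → ScaledVarAt vB (suc zero) (Gate.left (lookup gs s))
        left-scaled s ch≡j eq = ≋-trans (copies-val vA zero)
          (scaledVar-val pv′ (firstVar-unique Gate.left leftVar-notTimesOne gs staggered s (varChild-leaf ch≡j eq)) eq)
        right-scaled : ∀ s → ScaledVarAt vB zero (Gate.right (lookup gs s))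
        right-scaled s ch≡j eq =
          scaledVar-val vA (firstVar-unique Gate.right rightVar-notTimesOne gs staggered s (varChild-leaf ch≡j eq)) eq
        embedded : ∀ s → lookup (valsC gs pv′) (suc s) ≋ scale t (lookup (layerVals lv pv gs) s)
        embedded s = begin
          lookup (layerVals lv′ vB (Vec.map embedGate gs)) s
            ≡⟨ lookup-layerVals lv′ vB (Vec.map embedGate gs) s ⟩
          gateVal F lv′ vB (lookup (Vec.map embedGate gs) s)
            ≡⟨ ≡.cong (gateVal F lv′ vB) (VecP.lookup-map s embedGate gs) ⟩
          gateVal F lv′ vB (embedGate (lookup gs s))
            ≈⟨ embedGate-val pv vB (lookup gs s) prev-scaled (left-scaled s) (right-scaled s) ⟩
          scale t (gateVal F lv pv (lookup gs s))
            ≡⟨ ≡.cong (scale t) (lookup-layerVals lv pv gs s) ⟨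
          scale t (lookup (layerVals lv pv gs) s) ∎
          where open SetoidReasoning (≋-setoid n)

      skip-block : ∀ {p k} (gs : Vec (Gate F LP p) k) (pv′ : Vals (suc p)) (rest : Layers F L′ (suc k))
        {Q : Poly F n → Set ℓ} → Any Q (layersVals F lv′ (valsC gs pv′) rest) →
        Any Q (layersVals F lv′ pv′ (block gs rest))
      skip-block gs pv′ rest =
        AnyP.++⁺ʳ (Vec.toList (valsA gs pv′)) ∘ AnyP.++⁺ʳ (Vec.toList (valsB gs pv′)) ∘
        AnyP.++⁺ʳ (Vec.toList (valsC gs pv′))

      run-computes : ∀ {p} (P : Path LP p) (κ : Cont) {acc pv pv′} → StaggeredPath lvs P → Tracks acc pv pv′ →
        (Q : Poly F n → Set ℓ) →
        (∀ {k} (s : Fin k) (pvC : Vals (suc k)) → lookup pvC zero ≋ acc →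
           lookup pvC (suc s) ≋ scale t (pathVal lv pv P) → Any Q (layersVals F lv′ pvC (κ s))) →
        Any Q (layersVals F lv′ pv′ (run P κ))
      run-computes (end gs s) κ {acc} {pv} {pv′} staggered tracks Q found = skip-block gs pv′ (κ s)
        (found s (valsC gs pv′) (proj₁ tracked)
               (≋-trans (proj₂ tracked s) (≡⇒≋ (≡.cong (scale t) (lookup-layerVals lv pv gs s)))))
        where
        tracked : Tracks acc (layerVals lv pv gs) (valsC gs pv′)
        tracked = block-tracks gs staggered tracks
      run-computes (step gs P) κ {pv = pv} {pv′} (staggered , P-staggered) tracks Q found = skip-block gs pv′ (run P κ)
        (run-computes P κ P-staggered (block-tracks gs staggered {pv = pv} {pv′} tracks) Q found)

      block-width : ∀ {p k W} (gs : Vec (Gate F LP p) k) (rest : Layers F L′ (suc k)) → p ≤ W → k ≤ W →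
        widthL F rest ≤ 3 ℕ.+ W → widthL F (block gs rest) ≤ 3 ℕ.+ W
      block-width gs rest p≤W k≤W rest≤ = ℕP.⊔-lub (ℕP.m≤n⇒m≤1+n (ℕP.+-monoʳ-≤ 2 p≤W))
        (ℕP.⊔-lub (ℕP.+-monoʳ-≤ 3 p≤W) (ℕP.⊔-lub (ℕP.m≤n⇒m≤1+n (ℕP.m≤n⇒m≤1+n (s≤s k≤W))) rest≤))

      run-width : ∀ {p W} (P : Path LP p) (κ : Cont) → p ≤ W → PathWidth≤ W P →
        (∀ {k} (s : Fin k) → widthL F (κ s) ≤ 3 ℕ.+ W) → widthL F (run P κ) ≤ 3 ℕ.+ W
      run-width (end gs s)  κ p≤W k≤W          κ≤ = block-width gs (κ s) p≤W k≤W (κ≤ s)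
      run-width (step gs P) κ p≤W (k≤W , P≤W) κ≤ =
        block-width gs (run P κ) p≤W k≤W (run-width P κ k≤W P≤W κ≤)

      block-size : ∀ {p k R} (gs : Vec (Gate F LP p) k) (rest : Layers F L′ (suc k)) → sizeL F rest ≤ R →
        sizeL F (block gs rest) ≤ 2 ℕ.* p ℕ.+ k ℕ.+ 6 ℕ.+ R
      block-size {p} {k} {R} gs rest rest≤R = ℕP.≤-trans
        (ℕP.+-monoʳ-≤ (2 ℕ.+ p) (ℕP.+-monoʳ-≤ (3 ℕ.+ p) (ℕP.+-monoʳ-≤ (suc k) rest≤R)))
        (ℕP.≤-reflexive (count p k R))
        where
        count : ∀ p k R → (2 ℕ.+ p) ℕ.+ ((3 ℕ.+ p) ℕ.+ (suc k ℕ.+ R)) ≡ 2 ℕ.* p ℕ.+ k ℕ.+ 6 ℕ.+ R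
        count = solve-∀

      run-size : ∀ {p} (P : Path LP p) (κ : Cont) B → (∀ {k} (s : Fin k) → sizeL F (κ s) ≤ B) →
        sizeL F (run P κ) ≤ 2 ℕ.* p ℕ.+ 9 ℕ.* pathSize P ℕ.+ B
      run-size {p} (end {k = suc k} gs s) κ B κ≤ =
        ℕP.≤-trans (block-size gs (κ s) (κ≤ s)) (≤-by-slack (8 ℕ.* k ℕ.+ 2) (count p k B))
        where
        count : ∀ p k B → 2 ℕ.* p ℕ.+ suc k ℕ.+ 6 ℕ.+ B ℕ.+ (8 ℕ.* k ℕ.+ 2)
                          ≡ 2 ℕ.* p ℕ.+ 9 ℕ.* suc k ℕ.+ B
        count = solve-∀
      run-size {p} (step {k = k} gs P) κ B κ≤ =
        ℕP.≤-trans (block-size gs (run P κ) (run-size P κ B κ≤)) (≤-by-slack (6 ℕ.* k) (count p k (pathSize P) B))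
        where
        count : ∀ p k S B → 2 ℕ.* p ℕ.+ suc k ℕ.+ 6 ℕ.+ (2 ℕ.* suc k ℕ.+ 9 ℕ.* S ℕ.+ B) ℕ.+ 6 ℕ.* k
                            ≡ 2 ℕ.* p ℕ.+ 9 ℕ.* (suc k ℕ.+ S) ℕ.+ B
        count = solve-∀

    module Assembly (P : Path LP 0) (P-staggered : StaggeredPath lvs P) (zeroLeaf : ConstLeaf 0#) where
      open HomogeneousComponents F using (weightedScalings)

      f′ : Poly F n
      f′ = pathVal lv [] P

      weighLayer : ∀ {k c} → ConstLeaf c → Fin k → Vec (Gate F L′ (suc k)) 2
      weighLayer cLeaf s = gate times (prev (suc s)) (leaf (index cLeaf)) ∷ copy zero ∷ []

      addLayer : Vec (Gate F L′ 2) 1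
      addLayer = gate plus (prev zero) (prev (suc zero)) ∷ []

      finish : ∀ {c} → ConstLeaf c → Layers F L′ 1 → Cont
      finish cLeaf rest s = next (weighLayer cLeaf s) (next addLayer rest)

      sumLayers : ∀ {N} → (Fin N → WeightedNode) → Layers F L′ 1
      sumLayers {zero}  ws = done
      sumLayers {suc N} ws = Scaled.run (nodeLeaf (ws zero)) P (finish (weightLeaf (ws zero)) (sumLayers (ws ∘ suc)))

      initLayer : Vec (Gate F L′ 0) 1
      initLayer = gate plus (leaf (index zeroLeaf)) (leaf (index zeroLeaf)) ∷ []

      sumCircuit : ∀ {N} → (Fin N → WeightedNode) → Circuit F n
      sumCircuit ws = circuit lvs′ (next initLayer (sumLayers ws))

      sumLayers-staggered : ∀ {N} (ws : Fin N → WeightedNode) → StaggeredL F lvs′ (sumLayers ws)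
      sumLayers-staggered {zero}  ws = lift _
      sumLayers-staggered {suc N} ws = Scaled.run-staggered (nodeLeaf (ws zero)) P _ P-staggered λ s →
        timesOneTail-staggered _ _ (λ { zero → copy-isTimesOne zero }) ,
        timesOneTail-staggered _ _ (λ ()) ,
        sumLayers-staggered (ws ∘ suc)

      sumCircuit-staggered : ∀ {N} (ws : Fin N → WeightedNode) → IsStaggered F (sumCircuit ws)
      sumCircuit-staggered ws = timesOneTail-staggered _ _ (λ ()) , sumLayers-staggered ws

      sumLayers-computes : ∀ {N} (ws : Fin N → WeightedNode) (pv : Vals 1) {acc T : Poly F n} →
        lookup pv zero ≋ acc → T ≋ addP F acc (weightedScalings (node ∘ ws) (weight ∘ ws) f′) →
        Any (_≋ T) (Vec.toList pv ++ layersVals F lv′ pv (sumLayers ws))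
      sumLayers-computes {zero} ws (v ∷ []) acc≈ T≈ =
        here (≋-trans acc≈ (≋-sym (≋-trans T≈ (λ α → +-identityʳ _))))
      sumLayers-computes {suc N} ws pv {acc} {T} acc≈ T≈ = AnyP.++⁺ʳ (Vec.toList pv)
        (Scaled.run-computes (nodeLeaf w) P _ P-staggered (acc≈ , λ ()) (_≋ T) weighed)
        where
        w : WeightedNode
        w = ws zero
        term : Poly F n
        term α = scale (node w) f′ α * weight w
        weighed : ∀ {k} (s : Fin k) (pvC : Vals (suc k)) →
          lookup pvC zero ≋ acc → lookup pvC (suc s) ≋ scale (node w) f′ →
          Any (_≋ T) (layersVals F lv′ pvC (finish (weightLeaf w) (sumLayers (ws ∘ suc)) s))
        weighed s pvC acc≈′ scaled = AnyP.++⁺ʳ (Vec.toList (layerVals lv′ pvC (weighLayer (weightLeaf w) s)))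
          (sumLayers-computes (ws ∘ suc) _ {addP F term acc} added
            (λ α → trans (T≈ α) (trans (sym (+-assoc _ _ _)) (+-congʳ (+-comm _ _)))))
          where
          added : lookup (layerVals lv′ (layerVals lv′ pvC (weighLayer (weightLeaf w) s)) addLayer) zero ≋ addP F term acc
          added = addP-cong
            (≋-trans (mulP-cong scaled (≡⇒≋ (constLeaf-val (weightLeaf w)))) (mulP-constʳ _ (weight w)))
                            (≋-trans (copy-val pvC zero) acc≈′)

      sumCircuit-computes : ∀ {N} (ws : Fin N → WeightedNode) {T} →
        T ≋ weightedScalings (node ∘ ws) (weight ∘ ws) f′ → Computes F (sumCircuit ws) T
      sumCircuit-computes ws T≈ = AnyP.++⁺ʳ (Vec.toList lv′)
        (sumLayers-computes ws _ init≋0 (λ α → trans (T≈ α) (sym (+-identityˡ _))))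
        where
        zero≋0 : lookup lv′ (index zeroLeaf) ≋ λ _ → 0#
        zero≋0 = ≋-trans (≡⇒≋ (constLeaf-val zeroLeaf)) constP-0#
        init≋0 : lookup (layerVals lv′ [] initLayer) zero ≋ λ _ → 0#
        init≋0 = ≋-trans (addP-cong zero≋0 zero≋0) (λ α → +-identityˡ 0#)

      sumLayers-size : ∀ {N} (ws : Fin N → WeightedNode) → sizeL F (sumLayers ws) ≤ N ℕ.* (9 ℕ.* pathSize P ℕ.+ 3)
      sumLayers-size {zero}  ws = z≤n
      sumLayers-size {suc N} ws = ℕP.≤-trans
        (Scaled.run-size (nodeLeaf (ws zero)) P _ (3 ℕ.+ sizeL F (sumLayers (ws ∘ suc))) (λ _ → ℕP.≤-refl))
        (ℕP.≤-trans (ℕP.≤-reflexive (count (pathSize P) (sizeL F (sumLayers (ws ∘ suc)))))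
                    (ℕP.+-monoʳ-≤ (9 ℕ.* pathSize P ℕ.+ 3) (sumLayers-size (ws ∘ suc))))
        where
        count : ∀ S R → 2 ℕ.* 0 ℕ.+ 9 ℕ.* S ℕ.+ (3 ℕ.+ R) ≡ 9 ℕ.* S ℕ.+ 3 ℕ.+ R
        count = solve-∀

      sumLayers-width : ∀ {N W} (ws : Fin N → WeightedNode) → PathWidth≤ W P → widthL F (sumLayers ws) ≤ 3 ℕ.+ W
      sumLayers-width {zero}  ws P≤W = z≤n
      sumLayers-width {suc N} ws P≤W = Scaled.run-width (nodeLeaf (ws zero)) P _ z≤n P≤W λ _ →
        ℕP.⊔-lub (s≤s (s≤s z≤n)) (ℕP.⊔-lub (s≤s z≤n) (sumLayers-width (ws ∘ suc) P≤W))

module NewLeaves {a ℓ : Level} (F : Field a ℓ) {n N L : ℕ} (e c : Fin N → Field.Carrier F)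
                 (lvs : Vec (Leaf F n) L) where
  open Field F hiding (zero)

  extras : Vec Carrier (2 ℕ.+ (N ℕ.+ N))
  extras = 1# ∷ 0# ∷ Vec.tabulate e Vec.++ Vec.tabulate c

  lvs′ : Vec (Leaf F n) (2 ℕ.+ (N ℕ.+ N) ℕ.+ L)
  lvs′ = Vec.map const extras Vec.++ lvs

  open ConstLeaves F lvs′

  extra : ∀ k → ConstLeaf (lookup extras k)
  extra k = constLeaf (k ↑ˡ L) (≡.trans (VecP.lookup-++ˡ (Vec.map const extras) lvs k) (VecP.lookup-map k const extras))

  one : ConstLeaf 1#
  one = extra zero

  zeroLeaf : ConstLeaf 0#
  zeroLeaf = extra (suc zero)

  eLeaf : ∀ k → ConstLeaf (e k)
  eLeaf k = ≡.subst ConstLeaf (≡.trans (VecP.lookup-++ˡ (Vec.tabulate e) (Vec.tabulate c) k) (VecP.lookup∘tabulate e k))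
                    (extra (suc (suc (k ↑ˡ N))))

  cLeaf : ∀ k → ConstLeaf (c k)
  cLeaf k = ≡.subst ConstLeaf (≡.trans (VecP.lookup-++ʳ (Vec.tabulate e) (Vec.tabulate c) k) (VecP.lookup∘tabulate c k))
                    (extra (suc (suc (N ↑ʳ k))))

  nodes : Fin N → WeightedNode
  nodes k = record { nodeLeaf = eLeaf k ; weightLeaf = cLeaf k }

  embed : Fin L → Fin (2 ℕ.+ (N ℕ.+ N) ℕ.+ L)
  embed j = 2 ℕ.+ (N ℕ.+ N) ↑ʳ j

  embed-lookup : ∀ j → lookup lvs′ (embed j) ≡ lookup lvs j
  embed-lookup = VecP.lookup-++ʳ (Vec.map const extras) lvs

size-bound : ∀ {m s L S} → L ≤ s → S ≤ s →
  2 ℕ.+ (suc m ℕ.+ suc m) ℕ.+ L ℕ.+ suc (suc m ℕ.* (9 ℕ.* S ℕ.+ 3)) ≤ 20 ℕ.* suc (s ℕ.+ m) ℕ.^ 2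
size-bound {m} {s} L≤s S≤s = ℕP.≤-trans
  (ℕP.+-mono-≤ (ℕP.+-mono-≤ (ℕP.+-monoʳ-≤ 2 (ℕP.+-mono-≤ m<X m<X)) (ℕP.≤-trans L≤s s<X))
               (s≤s (ℕP.*-mono-≤ m<X (ℕP.+-monoˡ-≤ 3 (ℕP.*-monoʳ-≤ 9 (ℕP.≤-trans S≤s s<X))))))
  (≤-by-slack (11 ℕ.* Y ℕ.* Y ℕ.+ 16 ℕ.* Y ℕ.+ 2) (count Y))
  where
  Y : ℕ
  Y = s ℕ.+ m
  m<X : suc m ≤ suc Y
  m<X = s≤s (ℕP.m≤n+m m s)
  s<X : s ≤ suc Y
  s<X = ℕP.m≤n⇒m≤1+n (ℕP.m≤m+n s m)
  count : ∀ Y → 2 ℕ.+ (suc Y ℕ.+ suc Y) ℕ.+ suc Y ℕ.+ suc (suc Y ℕ.* (9 ℕ.* suc Y ℕ.+ 3))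
                  ℕ.+ (11 ℕ.* Y ℕ.* Y ℕ.+ 16 ℕ.* Y ℕ.+ 2)
                ≡ 20 ℕ.* (suc Y ℕ.* (suc Y ℕ.* 1))
  count = solve-∀

width-bound : ∀ {w W} → W ≤ suc w → 1 ℕ.⊔ (3 ℕ.+ W) ≤ w ℕ.+ 20
width-bound {w} W≤1+w = ℕP.⊔-lub (ℕP.≤-trans (s≤s z≤n) (ℕP.m≤n+m 20 w))
  (ℕP.≤-trans (ℕP.+-monoʳ-≤ 3 W≤1+w)
              (ℕP.≤-trans (ℕP.≤-reflexive (ℕP.+-comm 4 w)) (ℕP.+-monoʳ-≤ w (ℕP.m≤m+n 4 16))))

module HomogeneousCircuit {a ℓ : Level} (F : Field a ℓ) {n m L : ℕ} (e c : Fin (suc m) → Field.Carrier F)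
                          (lvs : Vec (Leaf F n) L) where
  open Field F hiding (zero)
  open Polynomials F
  open Paths F {n}
  open HomogeneousComponents F
  open NewLeaves F e c lvs
  open ConstLeaves F lvs′
  open Construction F lvs′ one

  weightedScalings-circuit : ∀ {LP} (lvsP : Vec (Leaf F n) LP) (ι : Fin LP → Fin (2 ℕ.+ (suc m ℕ.+ suc m) ℕ.+ L)) →
    (∀ j → lookup lvs′ (ι j) ≡ lookup lvsP j) →
    ∀ {f g S W s w} → PathTo lvsP [] f S W → g ≋ weightedScalings e c f → L ≤ s → S ≤ s → W ≤ suc w →
    Σ (Circuit F n) λ C′ → IsStaggered F C′ × Computes F C′ g ×
      size F C′ ≤ 20 ℕ.* suc (s ℕ.+ m) ℕ.^ 2 × width F C′ ≤ w ℕ.+ 20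
  weightedScalings-circuit lvsP ι ι-lookup π g≋ L≤s S≤s W≤1+w =
    sumCircuit nodes ,
    sumCircuit-staggered nodes ,
    sumCircuit-computes nodes (≋-trans g≋ (weightedScalings-cong e c (≋-sym (PathTo.computes π)))) ,
    ℕP.≤-trans (ℕP.+-monoʳ-≤ (2 ℕ.+ (suc m ℕ.+ suc m) ℕ.+ L) (s≤s (ℕP.≤-trans (sumLayers-size nodes)
                 (ℕP.*-monoʳ-≤ (suc m) (ℕP.+-monoˡ-≤ 3 (ℕP.*-monoʳ-≤ 9 (PathTo.size≤ π)))))))
               (size-bound L≤s S≤s) ,
    ℕP.≤-trans (ℕP.⊔-monoʳ-≤ 1 (sumLayers-width nodes (PathTo.width≤ π))) (width-bound W≤1+w)
    where
    open Embedded lvsP ι ι-lookup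
    open Assembly (PathTo.path π) (PathTo.staggered π) zeroLeaf

  -- A leaf f is reached through the single gate f × 1, which needs the new constant leaf 1.
  leafPath : ∀ j {f} → lookup (leafVals lvs) j ≋ f → PathTo lvs′ [] f 1 1
  leafPath j leaf≋f = record
    { path      = end (gate times (leaf (embed j)) (leaf (index one)) ∷ []) zero
    ; staggered = timesOneTail-staggered _ _ (λ ())
    ; computes  = ≋-trans (mulP-cong (≡⇒≋ (leafVals-≡ lvs lvs′ {j} {embed j} (embed-lookup j)))
                                     (≡⇒≋ (constLeaf-val one)))
                          (≋-trans (mulP-identityʳ _) leaf≋f)
    ; size≤     = ℕP.≤-refl
    ; width≤    = ℕP.≤-refl
    }

open import Data.Nat using (_+_; _*_; _^_)

lemma4 : ∀ {a ℓ : Level} →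
    Σ ℕ λ c → Σ ℕ λ d →
    (F : Field a ℓ) (n : ℕ) (f : Poly F n) (m s w : ℕ) (C : Circuit F n) →
    IsStaggered F C → size F C ≡ s → width F C ≡ w → Computes F C f →
    HasDegree F f m → AtLeast F (suc m) →
    (i : ℕ) → Σ (Circuit F n) λ C′ →
      IsStaggered F C′ × Computes F C′ (H F i f) ×
      size F C′ ≤ c * (suc (s + m)) ^ d × width F C′ ≤ w + c
lemma4 = 20 , 2 , λ where
  F n f m _ _ (circuit {L} lvs ls) staggered ≡.refl ≡.refl found degree (e , distinct) i →
    let open HomogeneousComponents F using (H-as-weightedScalings)
        open Paths F using (leaf-or-gate; pathTo-gate)
        c , H≋ = H-as-weightedScalings f degree e distinct i
        open HomogeneousCircuit F e c lvs
        open NewLeaves F e c lvs using (lvs′; embed; embed-lookup)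
        L≤s = ℕP.m≤m+n L (sizeL F ls)
    in case leaf-or-gate lvs ls found of λ where
      (inj₁ (j , leaf≋f)) → weightedScalings-circuit lvs′ id (λ _ → ≡.refl) (leafPath j leaf≋f) H≋
        L≤s (ℕP.≤-trans (ℕP.≤-trans (s≤s z≤n) (FinP.toℕ<n j)) L≤s) (s≤s z≤n)
      (inj₂ atGate) → weightedScalings-circuit lvs embed embed-lookup (pathTo-gate lvs ls staggered atGate) H≋
        L≤s (ℕP.m≤n+m (sizeL F ls) L) (ℕP.n≤1+n _)
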